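{- Let $\vec S$ be a finite universe of separations with an injective and structurally submodular order function $s\mapsto|s|$. Let $\mathcal F$ be a set that includes $\mathcal R(\vec S)$ and is rich and standard for $\vec S_k$ for every $k\in\mathbb R$. Then there exists a tree of the $\mathcal F$-tangles in $\vec S$, i.e. a nested set $N\subseteq S$ such that every two distinct maximal $\mathcal F$-tangles in $\vec S$ are distinguished optimally by a separation in $N$.
   Context: A universe of separations is a set $\vec S$ with a partial order $\le$ making it a lattice (supremum $\vee$, infimum $\wedge$) and an order-reversing involution $\vec s\mapsto\vec s^{\,*}=:\overleftarrow s$; $S=\{\{\vec s,\overleftarrow s\}\}$. The order function on $S$ is extended by $|\vec s|=|\overleftarrow s|=|s|$; it is structurally submodular if for all $\vec r,\vec s$, $|\vec r\vee\vec s|\le|\vec r|$ or $|\vec r\wedge\vec s|\le|\vec s|$. For $k\in\mathbb R$: $\vec S_k=\{\vec s:|s|<k\}$ (a separation system with induced order and involution), $S_k$ its unoriented separations. $\vec s$ is degenerate if $\vec s=\overleftarrow s$; $\vec s$ is trivial in $\vec S_k$ if some $t\in S_k$ has $\vec t<\vec s$ and $\overleftarrow t<\vec s$. Separations are nested if they have comparable orientations. A set $\sigma$ is consistent if there are no $\vec r,\vec s\in\sigma$ with $r\ne s$ and $\vec r<\overleftarrow s$. An $\mathcal F$-tangle of $S_k$ is a consistent set containing exactly one orientation of each element of $S_k$ (and nothing else), none of whose subsets lies in $\mathcal F$; these are the $\mathcal F$-tangles in $\vec S$. An $\mathcal F$-tangle $\tau$ of $S_k$ is maximal in $\vec S$ if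 there is no $\mathcal F$-tangle $\tau'\ne\tau$ of any $S_\ell$ with $\tau=\tau'\cap\vec S_k$. A separation $s\in S$ distinguishes two such partial orientations if both contain an orientation of $s$ and these differ; it distinguishes them optimally if moreover no separation in $S$ of lower order distinguishes them. $\mathcal R(\vec S):=\{\{\vec r,\overleftarrow r\vee\vec s,\overleftarrow r\vee\overleftarrow s\}\subseteq\vec S: r,s\in S,\ |\overleftarrow r\vee\vec s|,|\overleftarrow r\vee\overleftarrow s|<|r|\}$. $\mathcal F$ is standard for $\vec S_k$ if $\{\overleftarrow s\}\in\mathcal F$ for every $\vec s$ trivial in $\vec S_k$. $\vec s$ is weakly eclipsed by $\vec r$ if $\vec r<\vec s$ and $|r|\le|s|$; $\sigma\subseteq\tau$ is strongly efficient in $\tau$ if no element of $\sigma$ is weakly eclipsed by another element of $\tau$. $\mathcal F$ is rich for $\vec S_k$ if every consistent orientation of $S_k$ having a subset in $\mathcal F$ has a strongly efficient such subset.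
   Formalization: The order function $s\mapsto|s|$ takes rational values, and the thresholds $k$ range over ℚ instead of ℝ. -}

module Defs where

open import Level using (0ℓ)
open import Data.Nat using (ℕ)
open import Data.Fin using (Fin)
open import Data.Fin.Subset using (Subset; _∈_; _∉_; _⊆_; ⁅_⁆; _∪_)
open import Data.Rational using (ℚ; _<_; _≤_)
open import Data.Product using (Σ; ∃; ∃-syntax; _×_; _,_)
open import Data.Sum using (_⊎_)
open import Data.Empty using (⊥)
open import Relation.Nullary using (¬_)
open import Relation.Binary using (Rel)
open import Relation.Binary.PropositionalEquality using (_≡_; _≢_)
open import Relation.Binary.Lattice.Structures using (IsLattice)
open import Algebra.Core using (Op₂)
open import Function.Bundles using (_⇔_)

-- Its (finitely many) oriented
-- separations are enumerated as Fin n; sets of oriented separations are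
-- Data.Fin.Subset n (canonical representation, so equality of sets is ≡).
record Universe (n : ℕ) : Set₁ where
  infix 4 _≼_ _≺_
  infix 30 _*
  infixr 6 _∨_
  infixr 7 _∧_
  field
    _≼_       : Rel (Fin n) 0ℓ
    _∨_       : Op₂ (Fin n)
    _∧_       : Op₂ (Fin n)
    isLattice : IsLattice _≡_ _≼_ _∨_ _∧_
    _*        : Fin n → Fin n
    involutive : ∀ s → (s *) * ≡ s
    reversing  : ∀ {r s} → r ≼ s → (s *) ≼ (r *)

  _≺_ : Rel (Fin n) 0ℓ
  r ≺ s = r ≼ s × r ≢ s

  Orient : Fin n → Fin n → Set
  Orient s x = x ≡ s ⊎ x ≡ s *

  Same : Fin n → Fin n → Set
  Same r s = Orient s r

module Sep {n : ℕ} (U : Universe n) (∣_∣ : Fin n → ℚ) where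
  open Universe U

  OrderSymmetric : Set
  OrderSymmetric = ∀ s → ∣ s * ∣ ≡ ∣ s ∣

  -- injective on unoriented separations
  OrderInjective : Set
  OrderInjective = ∀ r s → ∣ r ∣ ≡ ∣ s ∣ → Same r s

  StructurallySubmodular : Set
  StructurallySubmodular = ∀ r s → (∣ r ∨ s ∣ ≤ ∣ r ∣) ⊎ (∣ r ∧ s ∣ ≤ ∣ s ∣)

  InS : ℚ → Fin n → Set
  InS k s = ∣ s ∣ < k

  TrivialIn : ℚ → Fin n → Set
  TrivialIn k s = InS k s × ∃[ t ] (InS k t × t ≺ s × (t *) ≺ s)

  Consistent : Subset n → Set
  Consistent σ = ¬ (∃[ r ] ∃[ s ] (r ∈ σ × s ∈ σ × (¬ Same r s) × r ≺ (s *)))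

  OrientationOf : ℚ → Subset n → Set
  OrientationOf k τ =
      (∀ s → s ∈ τ → InS k s)
    × (∀ s → InS k s → (s ∈ τ ⊎ (s *) ∈ τ))
    × (∀ s → s ∈ τ → (s *) ∈ τ → s ≡ s *)

  module _ (F : Subset n → Set) where

    Tangle : ℚ → Subset n → Set
    Tangle k τ = Consistent τ × OrientationOf k τ × (∀ σ → σ ⊆ τ → ¬ F σ)

    MaximalTangleAt : ℚ → Subset n → Set
    MaximalTangleAt k τ =
      Tangle k τ ×
      (∀ ℓ τ' → Tangle ℓ τ' → (∀ s → (s ∈ τ) ⇔ (s ∈ τ' × InS k s)) → τ' ≡ τ)

    MaximalTangle : Subset n → Set
    MaximalTangle τ = ∃[ k ] MaximalTangleAt k τ

    -- F ⊇ R(S⃗)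
    IncludesR : Set
    IncludesR = ∀ r s → ∣ (r *) ∨ s ∣ < ∣ r ∣ → ∣ (r *) ∨ (s *) ∣ < ∣ r ∣ →
                F (⁅ r ⁆ ∪ (⁅ (r *) ∨ s ⁆ ∪ ⁅ (r *) ∨ (s *) ⁆))

    StandardFor : ℚ → Set
    StandardFor k = ∀ s → TrivialIn k s → F ⁅ s * ⁆

    WeaklyEclipsed : Fin n → Fin n → Set
    WeaklyEclipsed s r = r ≺ s × ∣ r ∣ ≤ ∣ s ∣

    StronglyEfficient : Subset n → Subset n → Set
    StronglyEfficient σ τ = σ ⊆ τ × (∀ s r → s ∈ σ → r ∈ τ → ¬ WeaklyEclipsed s r)

    RichFor : ℚ → Set
    RichFor k = ∀ τ → Consistent τ → OrientationOf k τ →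
                (∃[ σ ] (σ ⊆ τ × F σ)) →
                ∃[ σ ] (StronglyEfficient σ τ × F σ)

  Distinguishes : Fin n → Subset n → Subset n → Set
  Distinguishes s τ τ' =
    ∃[ x ] ∃[ y ] (Orient s x × Orient s y × x ∈ τ × y ∈ τ' × x ≢ y)

  DistinguishesOptimally : Fin n → Subset n → Subset n → Set
  DistinguishesOptimally s τ τ' =
    Distinguishes s τ τ' × (∀ r → ∣ r ∣ < ∣ s ∣ → ¬ Distinguishes r τ τ')

  Nested : Fin n → Fin n → Set
  Nested r s = ∃[ x ] ∃[ y ] (Orient r x × Orient s y × (x ≼ y ⊎ y ≼ x))

  -- N (a set of separations, each given by any of its orientations) is nested
  NestedSet : Subset n → Set
  NestedSet N = ∀ r s → r ∈ N → s ∈ N → Nested r s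

  TreeOfTangles : (Subset n → Set) → Subset n → Set
  TreeOfTangles F N =
    NestedSet N ×
    (∀ τ τ' → MaximalTangle F τ → MaximalTangle F τ' → τ ≢ τ' →
      ∃[ s ] (s ∈ N × DistinguishesOptimally s τ τ'))

-- Call x ∨ y and x ∨ y* the corners of an oriented separation x with y, and call a corner low if
-- its order is less than |x|.  A separation is balanced if none of its orientations has two low
-- corners with the same y; the tree of tangles N consists of the balanced separations.
--
-- An optimal distinguisher s of two R-free tangles τ, τ' is balanced.  Let x* ∈ τ and x ∈ τ' be its
-- orientations.  If x* had two low corners with some y, τ would contain both (they lie above x*),
-- while τ', being R-free, cannot contain both together with x; so one of them would distinguish τ
-- and τ' at an order below |s|.
--
-- Two balanced separations r, s are nested.  Otherwise |r| ≠ |s| by injectivity, say |r| < |s|, and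
-- structural submodularity together with injectivity gives |x ∨ y| < |x| or |x* ∨ y*| < |y| for all
-- orientations x of r and y of s; chasing these inequalities through the four corners yields two
-- low corners on one side.

module Submission where

open import Defs
open import Level using (0ℓ)
open import Data.Nat using (ℕ)
open import Data.Fin using (Fin)
open import Data.Fin.Properties using (any?; all?; _≟_)
open import Data.Fin.Subset using (Subset; _∈_; _∉_; _⊆_; ⁅_⁆; _∪_)
open import Data.Fin.Subset.Properties using (_∈?_; x∈⁅y⁆⇒x≡y; x∈p∪q⁻)
open import Data.Rational using (ℚ; _<_; _≤_)
open import Data.Rational.Properties
  using (<-cmp; <-irrefl; <⇒≤; <-trans; <-≤-trans; ≤-reflexive; ≤-total; _<?_; ≤-decTotalOrder)
open import Data.Product using (∃; ∃-syntax; _×_; _,_; proj₁; proj₂)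
open import Data.Sum using (_⊎_; inj₁; inj₂; [_,_]; fromInj₁; swap)
open import Data.Empty using (⊥; ⊥-elim)
open import Data.Vec using (tabulate)
open import Data.Vec.Properties using (lookup∘tabulate; []=⇒lookup; lookup⇒[]=)
open import Data.List using (filter; allFin)
open import Data.List.Relation.Unary.All using (lookup)
open import Data.List.Relation.Unary.All.Properties using (all-filter)
open import Data.List.Membership.Propositional.Properties using (∈-filter⁺; ∈-allFin)
import Data.List.Extrema as Extrema
open import Function using (_∘_; id)
open import Function.Bundles using (_⇔_; mk⇔)
open import Relation.Nullary using (¬_; Dec; yes; no; does; ¬?)
open import Relation.Nullary.Decidable using (_×-dec_; _⊎-dec_; _→-dec_; dec-true; decidable-stable)
open import Relation.Unary using (Pred; Decidable)
open import Relation.Binary using (TotalOrder; DecTotalOrder; tri<; tri≈; tri>)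
open import Relation.Binary.Lattice using (Lattice)
import Relation.Binary.Lattice.Properties.JoinSemilattice as JoinSemilatticeProperties
open import Relation.Binary.PropositionalEquality using (_≡_; _≢_; refl; sym; trans; cong; subst; subst₂; module ≡-Reasoning)

module _ {b ℓ₁ ℓ₂} (O : TotalOrder b ℓ₁ ℓ₂) where
  open TotalOrder O using () renaming (Carrier to B; _≤_ to _⊑_)
  open Extrema O using (argmin; argmin-all; f[argmin]≤f[xs])

  ∃-argmin : ∀ {n p} {P : Pred (Fin n) p} (f : Fin n → B) → Decidable P → ∃ P →
             ∃[ t ] (P t × (∀ u → P u → f t ⊑ f u))
  ∃-argmin {n} f P? (t₀ , Pt₀) =
    argmin f t₀ candidates ,
    argmin-all f Pt₀ (all-filter P? (allFin n)) ,
    λ u Pu → lookup (f[argmin]≤f[xs] t₀ candidates) (∈-filter⁺ P? (∈-allFin u) Pu)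
    where candidates = filter P? (allFin n)

module _ {n p} {P : Pred (Fin n) p} (P? : Decidable P) where

  subsetOf : Subset n
  subsetOf = tabulate (does ∘ P?)

  ∈-subsetOf⁺ : ∀ {x} → P x → x ∈ subsetOf
  ∈-subsetOf⁺ {x} Px = lookup⇒[]= x subsetOf (trans (lookup∘tabulate _ x) (dec-true (P? x) Px))

  ∈-subsetOf⁻ : ∀ {x} → x ∈ subsetOf → P x
  ∈-subsetOf⁻ {x} x∈ with P? x | trans (sym (lookup∘tabulate _ x)) ([]=⇒lookup x∈)
  ... | yes Px | _ = Px

module _ {n} {p q r : Subset n} where

  ∪-least : p ⊆ r → q ⊆ r → p ∪ q ⊆ r
  ∪-least p⊆r q⊆r x∈p∪q = [ p⊆r , q⊆r ] (x∈p∪q⁻ p q x∈p∪q)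

⁅⁆⊆ : ∀ {n} {p : Subset n} {x} → x ∈ p → ⁅ x ⁆ ⊆ p
⁅⁆⊆ {p = p} {x} x∈p y∈⁅x⁆ = subst (_∈ p) (sym (x∈⁅y⁆⇒x≡y x y∈⁅x⁆)) x∈p

≤∧≢⇒< : ∀ {p q : ℚ} → p ≤ q → p ≢ q → p < q
≤∧≢⇒< {p} {q} p≤q p≢q with <-cmp p q
... | tri< p<q _ _ = p<q
... | tri≈ _ p≡q _ = ⊥-elim (p≢q p≡q)
... | tri> _ _ q<p = ⊥-elim (<-irrefl refl (<-≤-trans q<p p≤q))

module Involution {n : ℕ} (U : Universe n) where
  open Universe U public

  lattice : Lattice 0ℓ 0ℓ 0ℓ
  lattice = record
    { Carrier = Fin n ; _≈_ = _≡_ ; _≤_ = _≼_ ; _∨_ = _∨_ ; _∧_ = _∧_ ; isLattice = isLattice }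

  open Lattice lattice public
    using (antisym; x≤x∨y; y≤x∨y; ∨-least; x∧y≤x; x∧y≤y; ∧-greatest)
    renaming (refl to ≼-refl)
  open JoinSemilatticeProperties (Lattice.joinSemilattice lattice) public
    using (∨-comm)
    renaming (≈-dec⇒≤-dec to ≡-dec⇒≼-dec)

  _≼?_ : (x y : Fin n) → Dec (x ≼ y)
  _≼?_ = ≡-dec⇒≼-dec _≟_

  ≼-*ˡ : ∀ {x y} → x * ≼ y → y * ≼ x
  ≼-*ˡ {x} {y} x*≼y = subst (y * ≼_) (involutive x) (reversing x*≼y)

  ≼-*ʳ : ∀ {x y} → x ≼ y * → y ≼ x *
  ≼-*ʳ {x} {y} x≼y* = subst (_≼ x *) (involutive y) (reversing x≼y*)

  ∧-dual : ∀ x y → x ∧ y ≡ (x * ∨ y *) *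
  ∧-dual x y = antisym
    (≼-*ʳ (∨-least (reversing (x∧y≤x x y)) (reversing (x∧y≤y x y))))
    (∧-greatest (≼-*ˡ (x≤x∨y (x *) (y *))) (≼-*ˡ (y≤x∨y (x *) (y *))))

  orient-* : ∀ {s x} → Orient s x → Orient s (x *)
  orient-* (inj₁ refl) = inj₂ refl
  orient-* {s} (inj₂ refl) = inj₁ (involutive s)

  orient-*⁻ : ∀ {s x} → Orient (s *) x → Orient s x
  orient-*⁻ (inj₁ refl) = inj₂ refl
  orient-*⁻ {s} (inj₂ refl) = inj₁ (involutive s)

  orient-other : ∀ {s a b} → Orient s a → Orient s b → a ≢ b → b ≡ a *
  orient-other (inj₁ refl) (inj₁ refl) a≢b = ⊥-elim (a≢b refl)
  orient-other (inj₁ refl) (inj₂ refl) _ = refl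
  orient-other {s} (inj₂ refl) (inj₁ refl) _ = sym (involutive s)
  orient-other (inj₂ refl) (inj₂ refl) a≢b = ⊥-elim (a≢b refl)

  orientation-cases : ∀ {s a b z} → Orient s a → Orient s b → a ≢ b → Orient s z → z ≡ a ⊎ z ≡ b
  orientation-cases {a = a} {z = z} oa ob a≢b oz with z ≟ a
  ... | yes z≡a = inj₁ z≡a
  ... | no z≢a = inj₂ (trans (orient-other oa oz (z≢a ∘ sym)) (sym (orient-other oa ob a≢b)))

  Orient? : ∀ s x → Dec (Orient s x)
  Orient? s x = x ≟ s ⊎-dec x ≟ s *

module Separations {n : ℕ} (U : Universe n) (∣_∣ : Fin n → ℚ) (order-sym : Sep.OrderSymmetric U ∣_∣) where
  open Involution U
  open Sep U ∣_∣

  nested-sym : ∀ {r s} → Nested r s → Nested s r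
  nested-sym (x , y , ox , oy , comparable) = y , x , oy , ox , swap comparable

  same-nested : ∀ {r s} → Same r s → Nested r s
  same-nested {r} r~s = r , r , inj₁ refl , r~s , inj₁ ≼-refl

  Nested? : ∀ r s → Dec (Nested r s)
  Nested? r s = any? λ x → any? λ y → Orient? r x ×-dec Orient? s y ×-dec (x ≼? y ⊎-dec y ≼? x)

  distinguishes-sym : ∀ {t τ τ'} → Distinguishes t τ τ' → Distinguishes t τ' τ
  distinguishes-sym (x , y , ox , oy , x∈τ , y∈τ' , x≢y) = y , x , oy , ox , y∈τ' , x∈τ , x≢y ∘ sym

  Distinguishes? : ∀ t τ τ' → Dec (Distinguishes t τ τ')
  Distinguishes? t τ τ' = any? λ x → any? λ y →
    Orient? t x ×-dec Orient? t y ×-dec x ∈? τ ×-dec y ∈? τ' ×-dec ¬? (x ≟ y)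

  distinguishes-∉ : ∀ {c σ σ'} → c ∈ σ → c ∈ σ' ⊎ c * ∈ σ' → c ∉ σ' → Distinguishes c σ σ'
  distinguishes-∉ {σ' = σ'} c∈σ c∈σ'⊎c*∈σ' c∉σ' =
    _ , _ , inj₁ refl , inj₂ refl , c∈σ , c*∈σ' , λ c≡c* → c∉σ' (subst (_∈ σ') (sym c≡c*) c*∈σ')
    where c*∈σ' = [ ⊥-elim ∘ c∉σ' , id ] c∈σ'⊎c*∈σ'

  same-order : ∀ {s x} → Orient s x → ∣ x ∣ ≡ ∣ s ∣
  same-order (inj₁ refl) = refl
  same-order {s} (inj₂ refl) = order-sym s

  LowCorner : Fin n → Fin n → Set
  LowCorner x y = ∣ x ∨ y ∣ < ∣ x ∣

  NoLowCornerPair : Fin n → Set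
  NoLowCornerPair x = ∀ y → ¬ (LowCorner x y × LowCorner x (y *))

  Balanced : Fin n → Set
  Balanced s = ∀ x → Orient s x → NoLowCornerPair x

  Balanced? : ∀ s → Dec (Balanced s)
  Balanced? s = all? λ x → Orient? s x →-dec all? λ y → ¬? (lowCorner? x y ×-dec lowCorner? x (y *))
    where
    lowCorner? : ∀ x y → Dec (LowCorner x y)
    lowCorner? x y = ∣ x ∨ y ∣ <? ∣ x ∣

  lowCorner-swap : ∀ {x y} → ∣ x ∣ < ∣ y ∣ → LowCorner x y → LowCorner y x
  lowCorner-swap {x} {y} x<y low = subst (_< ∣ y ∣) (cong ∣_∣ (∨-comm x y)) (<-trans low x<y)

  module Crossing (order-inj : OrderInjective) (submodular : StructurallySubmodular) where

    join-order< : ∀ {r s x y} → ¬ Nested r s → Orient r x → Orient s y → ∣ x ∨ y ∣ ≤ ∣ x ∣ → LowCorner x y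
    join-order< {x = x} {y} crossing ox oy x∨y≤x =
      ≤∧≢⇒< x∨y≤x ([ below ox , below (orient-* ox) ] ∘ order-inj (x ∨ y) x)
      where
      below : ∀ {w} → Orient _ w → x ∨ y ≢ w
      below ow x∨y≡w = crossing (_ , y , ow , oy , inj₂ (subst (y ≼_) x∨y≡w (y≤x∨y x y)))

    ∧-order : ∀ x y → ∣ x ∧ y ∣ ≡ ∣ y * ∨ x * ∣
    ∧-order x y = begin
      ∣ x ∧ y ∣           ≡⟨ cong ∣_∣ (∧-dual x y) ⟩
      ∣ (x * ∨ y *) * ∣   ≡⟨ order-sym (x * ∨ y *) ⟩
      ∣ x * ∨ y * ∣       ≡⟨ cong ∣_∣ (∨-comm (x *) (y *)) ⟩
      ∣ y * ∨ x * ∣       ∎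
      where open ≡-Reasoning

    lowCorner-submodular : ∀ {r s x y} → ¬ Nested r s → Orient r x → Orient s y →
                           LowCorner x y ⊎ LowCorner (y *) (x *)
    lowCorner-submodular {x = x} {y} crossing ox oy with submodular x y
    ... | inj₁ x∨y≤x = inj₁ (join-order< crossing ox oy x∨y≤x)
    ... | inj₂ x∧y≤y = inj₂ (join-order< (crossing ∘ nested-sym) (orient-* oy) (orient-* ox)
                                         (subst₂ _≤_ (∧-order x y) (sym (order-sym y)) x∧y≤y))

    lowCorner-excluded : ∀ {r s x y} → ¬ Nested r s → Orient r x → Orient s y → ∣ x ∣ < ∣ y ∣ →
                         NoLowCornerPair x → NoLowCornerPair y → ¬ LowCorner x y
    lowCorner-excluded {x = x} {y} crossing ox oy x<y noPairˣ noPairʸ low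
      with lowCorner-submodular crossing ox (orient-* oy)
    ... | inj₁ low′ = noPairˣ y (low , low′)
    ... | inj₂ low′ = noPairʸ x (lowCorner-swap x<y low , subst (λ w → LowCorner w (x *)) (involutive y) low′)

    balanced-crossing-impossible : ∀ {r s} → ¬ Nested r s → ∣ r ∣ < ∣ s ∣ → Balanced r → Balanced s → ⊥
    balanced-crossing-impossible {r} {s} crossing r<s balancedʳ balancedˢ
      with lowCorner-submodular crossing (inj₁ refl) (inj₁ refl)
    ... | inj₁ low = lowCorner-excluded crossing (inj₁ refl) (inj₁ refl) r<s
                       (balancedʳ r (inj₁ refl)) (balancedˢ s (inj₁ refl)) low
    ... | inj₂ low with lowCorner-submodular (crossing ∘ nested-sym) (inj₂ refl) (inj₁ refl)
    ...   | inj₁ low′ = balancedˢ (s *) (inj₂ refl) r (low′ , low)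
    ...   | inj₂ low′ = lowCorner-excluded crossing (inj₂ refl) (inj₁ refl) r*<s
                          (balancedʳ (r *) (inj₂ refl)) (balancedˢ s (inj₁ refl))
                          (subst (LowCorner (r *)) (involutive s) low′)
      where r*<s = subst (_< ∣ s ∣) (sym (order-sym r)) r<s

    balanced-nested : ∀ {r s} → Balanced r → Balanced s → Nested r s
    balanced-nested {r} {s} balancedʳ balancedˢ with <-cmp ∣ r ∣ ∣ s ∣
    ... | tri< r<s _ _ = decidable-stable (Nested? r s)
                           λ crossing → balanced-crossing-impossible crossing r<s balancedʳ balancedˢ
    ... | tri≈ _ r≡s _ = same-nested (order-inj r s r≡s)
    ... | tri> _ _ s<r = nested-sym (decidable-stable (Nested? s r)
                           λ crossing → balanced-crossing-impossible crossing s<r balancedˢ balancedʳ)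

  OrientsBelow : ℚ → Subset n → Set
  OrientsBelow q σ = ∀ s → InS q s → s ∈ σ ⊎ s * ∈ σ

  RFree : Subset n → Set
  RFree σ = ∀ r s → ∣ r * ∨ s ∣ < ∣ r ∣ → ∣ r * ∨ s * ∣ < ∣ r ∣ →
            ¬ (r ∈ σ × r * ∨ s ∈ σ × r * ∨ s * ∈ σ)

  TangleLike : ℚ → Subset n → Set
  TangleLike q σ = Consistent σ × RFree σ × OrientsBelow q σ

  consistent-upward : ∀ {σ x z} → Consistent σ → x ∈ σ → x ≼ z → ¬ Same x z → z * ∉ σ
  consistent-upward {z = z} con x∈σ x≼z x≁z z*∈σ =
    con (_ , _ , x∈σ , z*∈σ , x≁z ∘ orient-*⁻ , x≼z** , x≁z ∘ inj₁ ∘ λ x≡z** → trans x≡z** (involutive z))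
    where
    x≼z** = subst (_ ≼_) (sym (involutive z)) x≼z

  lowCorner-∈ : ∀ {q σ x y} → Consistent σ → OrientsBelow q σ → ∣ x ∣ ≤ q → x ∈ σ →
                LowCorner x y → x ∨ y ∈ σ
  lowCorner-∈ {x = x} {y} con orients x≤q x∈σ low =
    fromInj₁ (⊥-elim ∘ consistent-upward con x∈σ (x≤x∨y x y) x≁x∨y) (orients _ (<-≤-trans low x≤q))
    where
    x≁x∨y : ¬ Same x (x ∨ y)
    x≁x∨y x~x∨y = <-irrefl (sym (same-order x~x∨y)) low

  noLowCornerPair : ∀ {s x σ σ'} → Orient s x →
    Consistent σ → OrientsBelow ∣ s ∣ σ → RFree σ' → OrientsBelow ∣ s ∣ σ' → x * ∈ σ → x ∈ σ' →
    (∀ c → ∣ c ∣ < ∣ s ∣ → ¬ Distinguishes c σ σ') → NoLowCornerPair (x *)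
  noLowCornerPair {s} {x} {σ} {σ'} ox con orients rfree orients' x*∈σ x∈σ' undistinguished
                  y (low₁ , low₂) =
    corners (x * ∨ y ∈? σ') (x * ∨ y * ∈? σ')
    where
    ∣x*∣≡∣s∣ : ∣ x * ∣ ≡ ∣ s ∣
    ∣x*∣≡∣s∣ = same-order (orient-* ox)

    lower : ∀ {z} → LowCorner (x *) z → ∣ x * ∨ z ∣ < ∣ s ∣
    lower {z} = subst (∣ x * ∨ z ∣ <_) ∣x*∣≡∣s∣

    distinguishing : ∀ {z} → LowCorner (x *) z → x * ∨ z ∉ σ' → ⊥
    distinguishing low c∉σ' = undistinguished _ (lower low)
      (distinguishes-∉ (lowCorner-∈ con orients (≤-reflexive ∣x*∣≡∣s∣) x*∈σ low) (orients' _ (lower low)) c∉σ')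

    corners : Dec (x * ∨ y ∈ σ') → Dec (x * ∨ y * ∈ σ') → ⊥
    corners (yes c₁∈σ') (yes c₂∈σ') =
      rfree x y (below low₁) (below low₂) (x∈σ' , c₁∈σ' , c₂∈σ')
      where
      below : ∀ {z} → LowCorner (x *) z → ∣ x * ∨ z ∣ < ∣ x ∣
      below {z} low = subst (∣ x * ∨ z ∣ <_) (sym (same-order ox)) (lower low)
    corners (no c₁∉σ') _ = distinguishing low₁ c₁∉σ'
    corners _ (no c₂∉σ') = distinguishing low₂ c₂∉σ'

  optimal-balanced : ∀ {s σ σ'} → TangleLike ∣ s ∣ σ → TangleLike ∣ s ∣ σ' →
                     DistinguishesOptimally s σ σ' → Balanced s
  optimal-balanced {s} {σ} {σ'} (con , rfree , orients) (con' , rfree' , orients')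
                   ((a , b , oa , ob , a∈σ , b∈σ' , a≢b) , optimal) z oz
    with orientation-cases oa ob a≢b oz
  ... | inj₁ refl = subst NoLowCornerPair (sym a≡b*)
    (noLowCornerPair ob con orients rfree' orients' (subst (_∈ σ) a≡b* a∈σ) b∈σ' optimal)
    where a≡b* = orient-other ob oa (a≢b ∘ sym)
  ... | inj₂ refl = subst NoLowCornerPair (sym b≡a*)
    (noLowCornerPair oa con' orients' rfree orients (subst (_∈ σ') b≡a* b∈σ') a∈σ
      λ c c<s → optimal c c<s ∘ distinguishes-sym)
    where b≡a* = orient-other oa ob a≢b

  distinguisher-order< : ∀ {k t τ τ'} → OrientationOf k τ → Distinguishes t τ τ' → ∣ t ∣ < k
  distinguisher-order< (inK , _ , _) (x , _ , ox , _ , x∈τ , _) = subst (_< _) (same-order ox) (inK x x∈τ)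

  undistinguished-∈ : ∀ {s τ τ'} → ¬ Distinguishes s τ τ' → s ∈ τ → s ∈ τ' ⊎ s * ∈ τ' → s ∈ τ'
  undistinguished-∈ {s} {τ' = τ'} undistinguished s∈τ oriented =
    decidable-stable (s ∈? τ') (undistinguished ∘ distinguishes-∉ s∈τ oriented)

  undistinguished-restriction : ∀ {k ℓ τ τ'} → OrientationOf k τ → OrientationOf ℓ τ' → k ≤ ℓ →
    (∀ t → ¬ Distinguishes t τ τ') → ∀ s → (s ∈ τ) ⇔ (s ∈ τ' × InS k s)
  undistinguished-restriction (inK , orientsK , _) (_ , orientsL , _) k≤ℓ undistinguished s = mk⇔
    (λ s∈τ → undistinguished-∈ (undistinguished s) s∈τ (orientsL s (<-≤-trans (inK s s∈τ) k≤ℓ)) , inK s s∈τ)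
    (λ (s∈τ' , s<k) → undistinguished-∈ (undistinguished s ∘ distinguishes-sym) s∈τ' (orientsK s s<k))

  maximalTangles-distinguished : ∀ {F τ τ'} → MaximalTangle F τ → MaximalTangle F τ' → τ ≢ τ' →
                                 ∃[ t ] Distinguishes t τ τ'
  maximalTangles-distinguished {τ = τ} {τ'} (k , tangleᵏ , maximalᵏ) (ℓ , tangleˡ , maximalˡ) τ≢τ' =
    decidable-stable (any? λ t → Distinguishes? t τ τ') (λ none → equal (≤-total k ℓ) λ t d → none (t , d))
    where
    equal : k ≤ ℓ ⊎ ℓ ≤ k → (∀ t → ¬ Distinguishes t τ τ') → ⊥
    equal (inj₁ k≤ℓ) undistinguished = τ≢τ' (sym (maximalᵏ ℓ τ' tangleˡ
      (undistinguished-restriction (proj₁ (proj₂ tangleᵏ)) (proj₁ (proj₂ tangleˡ)) k≤ℓ undistinguished)))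
    equal (inj₂ ℓ≤k) undistinguished = τ≢τ' (maximalˡ k τ tangleᵏ
      (undistinguished-restriction (proj₁ (proj₂ tangleˡ)) (proj₁ (proj₂ tangleᵏ)) ℓ≤k
        λ t → undistinguished t ∘ distinguishes-sym))

  optimal-distinguisher : ∀ {τ τ'} → ∃[ t ] Distinguishes t τ τ' → ∃[ t ] DistinguishesOptimally t τ τ'
  optimal-distinguisher {τ} {τ'} distinguished
    with ∃-argmin (DecTotalOrder.totalOrder ≤-decTotalOrder) ∣_∣ (λ t → Distinguishes? t τ τ') distinguished
  ... | t , t-distinguishes , least =
    t , t-distinguishes , λ u u<t u-distinguishes → <-irrefl refl (<-≤-trans u<t (least u u-distinguishes))

  tangle-RFree : ∀ {F τ} → IncludesR F → (∀ σ → σ ⊆ τ → ¬ F σ) → RFree τ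
  tangle-RFree includesR no-F r s low₁ low₂ (r∈τ , c₁∈τ , c₂∈τ) =
    no-F _ (∪-least (⁅⁆⊆ r∈τ) (∪-least (⁅⁆⊆ c₁∈τ) (⁅⁆⊆ c₂∈τ))) (includesR r s low₁ low₂)

  tangle-tangleLike : ∀ {F k q τ} → IncludesR F → Tangle F k τ → q ≤ k → TangleLike q τ
  tangle-tangleLike includesR (consistent , (_ , orients , _) , no-F) q≤k =
    consistent , tangle-RFree includesR no-F , λ s s<q → orients s (<-≤-trans s<q q≤k)

  tangles-optimal-balanced : ∀ {F k ℓ t τ τ'} → IncludesR F → Tangle F k τ → Tangle F ℓ τ' →
                             DistinguishesOptimally t τ τ' → Balanced t
  tangles-optimal-balanced includesR tangle tangle' optimal@(distinguishes , _) = optimal-balanced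
    (tangle-tangleLike includesR tangle (<⇒≤ (distinguisher-order< (proj₁ (proj₂ tangle)) distinguishes)))
    (tangle-tangleLike includesR tangle'
      (<⇒≤ (distinguisher-order< (proj₁ (proj₂ tangle')) (distinguishes-sym distinguishes))))
    optimal

theorem6p10 : ∀ {n : ℕ} (U : Universe n) (∣_∣ : Fin n → ℚ) (F : Subset n → Set) →
    Sep.OrderSymmetric U ∣_∣ →
    Sep.OrderInjective U ∣_∣ →
    Sep.StructurallySubmodular U ∣_∣ →
    Sep.IncludesR U ∣_∣ F →
    (∀ k → Sep.RichFor U ∣_∣ F k) →
    (∀ k → Sep.StandardFor U ∣_∣ F k) →
    ∃[ N ] Sep.TreeOfTangles U ∣_∣ F N
theorem6p10 {n} U ∣_∣ F order-sym order-inj submodular includesR _ _ = N , N-nested , N-distinguishes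
  where
  open Sep U ∣_∣
  open Separations U ∣_∣ order-sym
  open Crossing order-inj submodular

  N : Subset n
  N = subsetOf Balanced?

  N-nested : NestedSet N
  N-nested r s r∈N s∈N = balanced-nested (∈-subsetOf⁻ Balanced? r∈N) (∈-subsetOf⁻ Balanced? s∈N)

  N-distinguishes : ∀ τ τ' → MaximalTangle F τ → MaximalTangle F τ' → τ ≢ τ' →
                    ∃[ s ] (s ∈ N × DistinguishesOptimally s τ τ')
  N-distinguishes τ τ' maximal@(_ , tangle , _) maximal'@(_ , tangle' , _) τ≢τ'
    with optimal-distinguisher (maximalTangles-distinguished maximal maximal' τ≢τ')
  ... | t , optimal =
    t , ∈-subsetOf⁺ Balanced? (tangles-optimal-balanced includesR tangle tangle' optimal) , optimal
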